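{- For every Alternating Linear Clobber game $G$ (a finite sum of parts each belonging to $\mathcal{U}$), Algorithm ASF applied to $G$ terminates, and the game it returns is equivalent to $G$.
   Context: Linear clobber: Left owns black stones \texttt{x}, Right owns white stones \texttt{o}, on a path; on a turn a player takes one of their stones adjacent to an opponent stone, removes the opponent stone and moves their stone into its cell. Whoever cannot move loses (normal play). A part is a maximal run of consecutive stones, written as a string over $\{\texttt{x},\texttt{o}\}$, identified with its reversal; a position is the (disjunctive) sum of its parts. A part is trivial if it has no two adjacent stones of different colors. $\mathcal{U}$ is the set of non-trivial parts appearing in some game starting from a part $(\texttt{ox})^n$, $n\ge1$. The negative $-p$ of a part swaps every color. Games $g,h$ are equivalent if for every game $x$, $g+x$ and $h+x$ have the same outcome class (equivalently, $g+(-h)$ is a second-player win). Algorithm ASF: regard a game as a multiset of parts. Repeatedly apply the first applicable rule in the preference order $\alpha,-\alpha,\beta,-\beta,\gamma,-\gamma,\delta,-\delta,\varepsilon,-\varepsilon,\zeta,-\zeta,\eta,-\eta$ until no rule applies, where: $\alpha$: delete any part equal to \texttt{o}, \texttt{oo}, \texttt{ooo}, \texttt{ooxx} or \texttt{oxoxox}; $\beta$: if parts $p$ and $-p$ both occur, delete both; $\gamma$: replace any part \texttt{oxo}, \texttt{ooxox}, \texttt{ooxoxoo}, \texttt{xxoxoxx} by \texttt{ox}; $\delta$: replace \texttt{oxoxoxoxo} by \texttt{ooxo}; $\varepsilon$: replace \texttt{ooxoxx} or \texttt{oxoxoxoxoxox} by the two parts \texttt{oxox} and \texttt{ox}; $\zeta$: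 replace \texttt{ooxoo} by \texttt{oox}; $\eta$: replace \texttt{ooxo} by the two parts \texttt{xxo} and \texttt{ox}. For each rule $\rho$, rule $-\rho$ is obtained by replacing every part on both sides of $\rho$ by its negative. -}

module Defs where

open import Data.Nat using (ℕ; zero; suc; _+_; _≥_)
open import Data.Bool using (Bool; true; false; _∧_; _∨_)
open import Data.List using (List; []; _∷_; _++_; map; concat; concatMap; reverse; length; replicate)
open import Data.Nat.ListAction using (sum)
open import Data.List.Relation.Unary.All using (All)
open import Data.List.Membership.Propositional using (_∈_)
open import Data.Product using (Σ; _×_; _,_; ∃; ∃-syntax)
open import Data.Sum using (_⊎_)
open import Relation.Binary.PropositionalEquality using (_≡_)
open import Relation.Nullary using (¬_)
open import Relation.Binary.Construct.Closure.ReflexiveTransitive using (Star)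
open import Induction.WellFounded using (Acc)

data Game : Set where
  mk : List Game → List Game → Game   -- mk LeftOptions RightOptions

mutual
  _⊕_ : Game → Game → Game
  g@(mk GL GR) ⊕ h@(mk HL HR) =
    mk (sumL GL h ++ sumR g HL) (sumL GR h ++ sumR g HR)

  sumL : List Game → Game → List Game
  sumL []       h = []
  sumL (g ∷ gs) h = (g ⊕ h) ∷ sumL gs h

  sumR : Game → List Game → List Game
  sumR g []       = []
  sumR g (h ∷ hs) = (g ⊕ h) ∷ sumR g hs

-- Winning under normal play.
--   leftFirst  g : Left, moving first in g, has a winning strategy
--   leftSecond g : Left, moving second in g, has a winning strategy
--   rightFirst / rightSecond analogously.
mutual
  leftFirst : Game → Bool
  leftFirst (mk L R) = anyLeftSecond L

  leftSecond : Game → Bool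
  leftSecond (mk L R) = allLeftFirst R

  anyLeftSecond : List Game → Bool
  anyLeftSecond []       = false
  anyLeftSecond (g ∷ gs) = leftSecond g ∨ anyLeftSecond gs

  allLeftFirst : List Game → Bool
  allLeftFirst []       = true
  allLeftFirst (g ∷ gs) = leftFirst g ∧ allLeftFirst gs

mutual
  rightFirst : Game → Bool
  rightFirst (mk L R) = anyRightSecond R

  rightSecond : Game → Bool
  rightSecond (mk L R) = allRightFirst L

  anyRightSecond : List Game → Bool
  anyRightSecond []       = false
  anyRightSecond (g ∷ gs) = rightSecond g ∨ anyRightSecond gs

  allRightFirst : List Game → Bool
  allRightFirst []       = true
  allRightFirst (g ∷ gs) = rightFirst g ∧ allRightFirst gs

-- The outcome class of a (finite, hence determined) game is determined by
-- who wins when Left starts and who wins when Right starts.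
outcome : Game → Bool × Bool
outcome g = leftFirst g , rightFirst g

_≈G_ : Game → Game → Set
g ≈G h = ∀ (x : Game) → outcome (g ⊕ x) ≡ outcome (h ⊕ x)

data Stone : Set where
  x o : Stone

Part : Set
Part = List Stone

-- a position is a multiset of parts, represented as a list
Position : Set
Position = List Part

data Player : Set where
  Left Right : Player

-- Left owns black stones x, Right owns white stones o
stoneOf : Player → Stone
stoneOf Left  = x
stoneOf Right = o

negStone : Stone → Stone
negStone x = o
negStone o = x

negPart : Part → Part
negPart = map negStone

splits : Part → List (Part × Stone × Stone × Part)
splits (a ∷ b ∷ s) = ([] , a , b , s) ∷ map ext (splits (b ∷ s))
  where
  ext : Part × Stone × Stone × Part → Part × Stone × Stone × Part
  ext (pre , a' , b' , s') = (a ∷ pre , a' , b' , s')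
splits _ = []

-- drop empty parts (an emptied cell separates the path)
nonEmpty : List Part → List Part
nonEmpty []            = []
nonEmpty ([] ∷ ps)     = nonEmpty ps
nonEmpty ((s ∷ p) ∷ ps) = (s ∷ p) ∷ nonEmpty ps

-- moves at an adjacent pair (a , b) for a player; the vacated cell splits the part
movePair : Player → Part × Stone × Stone × Part → List (List Part)
movePair Left  (pre , x , o , suf) = nonEmpty (pre ∷ (x ∷ suf) ∷ []) ∷ []
movePair Left  (pre , o , x , suf) = nonEmpty ((pre ++ x ∷ []) ∷ suf ∷ []) ∷ []
movePair Right (pre , o , x , suf) = nonEmpty (pre ∷ (o ∷ suf) ∷ []) ∷ []
movePair Right (pre , x , o , suf) = nonEmpty ((pre ++ o ∷ []) ∷ suf ∷ []) ∷ []
movePair _     _                    = []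

partMoves : Player → Part → List (List Part)
partMoves P p = concatMap (movePair P) (splits p)

picks : {A : Set} → List A → List (List A × A × List A)
picks []       = []
picks (a ∷ as) = ([] , a , as) ∷ map ext (picks as)
  where
  ext : _ → _
  ext (pre , b , suf) = (a ∷ pre , b , suf)

options : Player → Position → List Position
options P G = concatMap opt (picks G)
  where
  opt : List Part × Part × List Part → List Position
  opt (pre , p , suf) = map (λ new → pre ++ new ++ suf) (partMoves P p)

stones : Position → ℕ
stones G = sum (map length G)

-- the game tree of a position (fuel ≥ number of stones + 1 suffices,
-- since every move removes a stone)
toGameF : ℕ → Position → Game
toGameF zero    G = mk [] []
toGameF (suc n) G = mk (map (toGameF n) (options Left G)) (map (toGameF n) (options Right G))

toGame : Position → Game
toGame G = toGameF (suc (stones G)) G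

_≈_ : Position → Position → Set
G ≈ H = toGame G ≈G toGame H

data Move : Position → Position → Set where
  move : ∀ (P : Player) {G H} → H ∈ options P G → Move G H

Reachable : Position → Position → Set
Reachable = Star Move

oxPow : ℕ → Part
oxPow zero    = []
oxPow (suc n) = o ∷ x ∷ oxPow n

data NonTrivial : Part → Set where
  here-ox : ∀ {s} → NonTrivial (o ∷ x ∷ s)
  here-xo : ∀ {s} → NonTrivial (x ∷ o ∷ s)
  there   : ∀ {a s} → NonTrivial s → NonTrivial (a ∷ s)

-- parts are identified with their reversal
_≅_ : Part → Part → Set
p ≅ q = p ≡ q ⊎ p ≡ reverse q

InU : Part → Set
InU p = NonTrivial p ×
  ∃[ n ] (n ≥ 1 × ∃[ G ] (Reachable (oxPow n ∷ []) G × ∃[ q ] (q ∈ G × p ≅ q)))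

ALC : Position → Set
ALC G = All InU G

data Rule : Set where
  rw     : List (Part × List Part) → Rule
  cancel : Rule

negRule : Rule → Rule
negRule (rw alts) = rw (map (λ { (q , rs) → negPart q , map negPart rs }) alts)
negRule cancel    = cancel

data Applies : Rule → Position → Position → Set where
  app-rw : ∀ {alts} pre p suf q rs →
           (q , rs) ∈ alts → p ≅ q →
           Applies (rw alts) (pre ++ p ∷ suf) (pre ++ rs ++ suf)
  app-cancel : ∀ A p B p' C → p' ≅ negPart p →
           Applies cancel (A ++ p ∷ B ++ p' ∷ C) (A ++ B ++ C)

Applicable : Rule → Position → Set
Applicable ρ G = ∃[ G' ] Applies ρ G G'

ruleα ruleβ ruleγ ruleδ ruleε ruleζ ruleη : Rule
ruleα = rw ( (o ∷ [] , [])
           ∷ (o ∷ o ∷ [] , [])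
           ∷ (o ∷ o ∷ o ∷ [] , [])
           ∷ (o ∷ o ∷ x ∷ x ∷ [] , [])
           ∷ (o ∷ x ∷ o ∷ x ∷ o ∷ x ∷ [] , [])
           ∷ [])
ruleβ = cancel
ruleγ = rw ( (o ∷ x ∷ o ∷ [] , (o ∷ x ∷ []) ∷ [])
           ∷ (o ∷ o ∷ x ∷ o ∷ x ∷ [] , (o ∷ x ∷ []) ∷ [])
           ∷ (o ∷ o ∷ x ∷ o ∷ x ∷ o ∷ o ∷ [] , (o ∷ x ∷ []) ∷ [])
           ∷ (x ∷ x ∷ o ∷ x ∷ o ∷ x ∷ x ∷ [] , (o ∷ x ∷ []) ∷ [])
           ∷ [])
ruleδ = rw ( (o ∷ x ∷ o ∷ x ∷ o ∷ x ∷ o ∷ x ∷ o ∷ [] , (o ∷ o ∷ x ∷ o ∷ []) ∷ []) ∷ [])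
ruleε = rw ( (o ∷ o ∷ x ∷ o ∷ x ∷ x ∷ [] , (o ∷ x ∷ o ∷ x ∷ []) ∷ (o ∷ x ∷ []) ∷ [])
           ∷ (oxPow 6 , (o ∷ x ∷ o ∷ x ∷ []) ∷ (o ∷ x ∷ []) ∷ [])
           ∷ [])
ruleζ = rw ( (o ∷ o ∷ x ∷ o ∷ o ∷ [] , (o ∷ o ∷ x ∷ []) ∷ []) ∷ [])
ruleη = rw ( (o ∷ o ∷ x ∷ o ∷ [] , (x ∷ x ∷ o ∷ []) ∷ (o ∷ x ∷ []) ∷ []) ∷ [])

-- preference order α, -α, β, -β, …, η, -η
asfRules : List Rule
asfRules = concatMap (λ ρ → ρ ∷ negRule ρ ∷ [])
  (ruleα ∷ ruleβ ∷ ruleγ ∷ ruleδ ∷ ruleε ∷ ruleζ ∷ ruleη ∷ [])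

-- one step of ASF: apply the first applicable rule (to any matching occurrence)
data ASFStep (G G' : Position) : Set where
  step : ∀ earlier ρ later → asfRules ≡ earlier ++ ρ ∷ later →
         All (λ r → ¬ Applicable r G) earlier →
         Applies ρ G G' → ASFStep G G'

Halted : Position → Set
Halted G = All (λ r → ¬ Applicable r G) asfRules

Terminates : Position → Set
Terminates G = Acc (λ H G′ → ASFStep G′ H) G

module Submission where

-- Every ASF rule either deletes a pair p, −p, whose sum is 0, or replaces one part by a
-- sum of parts of the same game value. The latter are finitely many identities between
-- short games; they are verified by computation, from a table of canonical values of the
-- parts involved whose every entry is checked against the options of its part. As the
-- value of a position is the sum of the values of its parts, in any order, and equality
-- of games is a congruence for sums, every step preserves the outcome class against
-- every summand x. Each step also decreases the sum of 1 + |p|² over the parts, so every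
-- run terminates, and as applicability of each rule is decidable, some run halts.

open import Defs
open import Data.Bool using (Bool; true; false; _∧_; _∨_; T)
open import Data.Bool.Properties using (T-∧; T-∨)
open import Data.Empty using (⊥-elim)
open import Data.Bool.ListAction using (all)
open import Data.List using (List; []; _∷_; _++_; map; concatMap; reverse; length; [_])
open import Data.List.Membership.Propositional using (_∈_; find; lose)
open import Data.List.Membership.Propositional.Properties
  using (∈-++⁻; ∈-++⁺ˡ; ∈-++⁺ʳ; ∈-map⁻; ∈-map⁺; ∈-concatMap⁻; ∈-concatMap⁺; ∈-insert; ∈-∃++)
open import Data.List.Properties
  using ( ≡-dec; map-++; map-∘; ++-assoc; ++-identityʳ; length-++; length-++-sucʳ; length-reverse
        ; reverse-++; reverse-involutive; unfold-reverse; concatMap-map; concatMap-cong; map-concatMap)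
open import Data.List.Relation.Binary.Permutation.Propositional using (_↭_; ↭-prep; ↭-sym; ↭-trans)
import Data.List.Relation.Binary.Permutation.Propositional as Perm
open import Data.List.Relation.Binary.Permutation.Propositional.Properties using (shift; shifts; ++⁺ˡ; map⁺)
open import Data.List.Relation.Binary.Pointwise using (Pointwise; []; _∷_)
open import Data.List.Relation.Unary.All using (All; []; _∷_; lookup)
open import Data.List.Relation.Unary.All.Properties using (all⁺)
open import Data.List.Relation.Unary.Any using (Any; here; there; any?)
open import Data.List.Relation.Unary.Any.Properties using (++⁺ʳ)
import Data.List.Relation.Unary.First as First
open First using (First; first)
open import Data.Maybe using (Maybe; just; nothing; zipWith)
open import Data.Nat using (ℕ; suc; _+_; _*_; _<_; _<ᵇ_; s≤s; z<s)
open import Data.Nat.Induction using (<-wellFounded)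
open import Data.Nat.ListAction using (sum)
open import Data.Nat.ListAction.Properties using (sum-++; sum-↭)
open import Data.Nat.Properties using (+-suc; +-identityʳ; ≤-reflexive; m≤m+n; m≤n+m; m<n+m; +-monoˡ-<; <ᵇ⇒<; module ≤-Reasoning)
open import Data.Product using (_×_; _,_; ∃-syntax; proj₁; proj₂)
open import Data.Sum using (_⊎_; inj₁; inj₂; [_,_]′; swap)
open import Function.Base using (_∘_)
open import Function.Bundles using (Equivalence)
open import Induction.WellFounded using (Acc; acc; WellFounded; module Subrelation)
import Relation.Binary.Construct.On as On
open import Relation.Binary.Construct.Closure.ReflexiveTransitive using (Star; ε; _◅_)
open import Relation.Binary.Definitions using (DecidableEquality)
open import Relation.Binary.PropositionalEquality
  using (_≡_; refl; sym; trans; cong; cong₂; subst; subst₂; module ≡-Reasoning)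
open import Relation.Nullary using (Dec; yes; no)
open import Relation.Nullary.Decidable using (map′; toSum; _⊎-dec_)

open Equivalence using (to; from)

-- Short games

opts : Player → Game → List Game
opts Left  (mk L R) = L
opts Right (mk L R) = R

data _⊏_ (a : Game) : Game → Set where
  option : ∀ P {g} → a ∈ opts P g → a ⊏ g

mutual
  ⊏-wellFounded : WellFounded _⊏_
  ⊏-wellFounded (mk L R) = acc λ { (option Left m) → acc-∈ L m ; (option Right m) → acc-∈ R m }

  acc-∈ : ∀ gs {a} → a ∈ gs → Acc _⊏_ a
  acc-∈ (g ∷ gs) (here refl) = ⊏-wellFounded g
  acc-∈ (g ∷ gs) (there m)   = acc-∈ gs m

infix 4 _≼_ _◁_ _≃_

-- Conway's order ≼, and ◁ ("less than or confused with").
data _≼_ : Game → Game → Set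
data _◁_ : Game → Game → Set

data _≼_ where
  ≼-intro : ∀ {g h} → (∀ {a} → a ∈ opts Left g → a ◁ h) → (∀ {b} → b ∈ opts Right h → g ◁ b) → g ≼ h

data _◁_ where
  ◁-left  : ∀ {g h a} → a ∈ opts Left h → g ≼ a → g ◁ h
  ◁-right : ∀ {g h b} → b ∈ opts Right g → b ≼ h → g ◁ h

≼-refl-acc : ∀ g → Acc _⊏_ g → g ≼ g
≼-refl-acc g (acc rs) = ≼-intro (λ m → ◁-left m (≼-refl-acc _ (rs (option Left m))))
                                (λ m → ◁-right m (≼-refl-acc _ (rs (option Right m))))

mutual
  ≼-trans : ∀ {g h k} → g ≼ h → h ≼ k → g ≼ k
  ≼-trans p@(≼-intro pl _) q@(≼-intro _ qr) = ≼-intro (λ m → ◁-≼-trans (pl m) q) (λ m → ≼-◁-trans p (qr m))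

  ≼-◁-trans : ∀ {g h k} → g ≼ h → h ◁ k → g ◁ k
  ≼-◁-trans p               (◁-left m q)  = ◁-left m (≼-trans p q)
  ≼-◁-trans (≼-intro _ pr) (◁-right m q) = ◁-≼-trans (pr m) q

  ◁-≼-trans : ∀ {g h k} → g ◁ h → h ≼ k → g ◁ k
  ◁-≼-trans (◁-left m q)  (≼-intro ql _) = ≼-◁-trans q (ql m)
  ◁-≼-trans (◁-right m q) p              = ◁-right m (≼-trans q p)

_≃_ : Game → Game → Set
g ≃ h = g ≼ h × h ≼ g

≃-refl : ∀ {g} → g ≃ g
≃-refl {g} = ≼-refl-acc g (⊏-wellFounded g) , ≼-refl-acc g (⊏-wellFounded g)

≃-sym : ∀ {g h} → g ≃ h → h ≃ g
≃-sym (p , q) = q , p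

infixr 2 _⟫_

_⟫_ : ∀ {g h k} → g ≃ h → h ≃ k → g ≃ k
(p , q) ⟫ (p′ , q′) = ≼-trans p p′ , ≼-trans q′ q

OptionsMatch : List Game → List Game → Set
OptionsMatch as bs = (∀ {a} → a ∈ as → ∃[ b ] (b ∈ bs × a ≃ b)) × (∀ {b} → b ∈ bs → ∃[ a ] (a ∈ as × a ≃ b))

≃-intro : ∀ {g h} → (∀ P → OptionsMatch (opts P g) (opts P h)) → g ≃ h
≃-intro match =
  ≼-intro (λ m → let (b , mb , e) = proj₁ (match Left) m in ◁-left mb (proj₁ e))
          (λ m → let (a , ma , e) = proj₂ (match Right) m in ◁-right ma (proj₁ e)) ,
  ≼-intro (λ m → let (a , ma , e) = proj₂ (match Left) m in ◁-left ma (proj₂ e))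
          (λ m → let (b , mb , e) = proj₁ (match Right) m in ◁-right mb (proj₂ e))

sumL≡map : ∀ gs h → sumL gs h ≡ map (_⊕ h) gs
sumL≡map []       h = refl
sumL≡map (g ∷ gs) h = cong (g ⊕ h ∷_) (sumL≡map gs h)

sumR≡map : ∀ g hs → sumR g hs ≡ map (g ⊕_) hs
sumR≡map g []       = refl
sumR≡map g (h ∷ hs) = cong (g ⊕ h ∷_) (sumR≡map g hs)

opts-⊕ : ∀ P g h → opts P (g ⊕ h) ≡ map (_⊕ h) (opts P g) ++ map (g ⊕_) (opts P h)
opts-⊕ Left  (mk GL GR) (mk HL HR) = cong₂ _++_ (sumL≡map GL _) (sumR≡map _ HL)
opts-⊕ Right (mk GL GR) (mk HL HR) = cong₂ _++_ (sumL≡map GR _) (sumR≡map _ HR)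

data SumOption (P : Player) (g h : Game) : Game → Set where
  inˡ : ∀ {a} → a ∈ opts P g → SumOption P g h (a ⊕ h)
  inʳ : ∀ {b} → b ∈ opts P h → SumOption P g h (g ⊕ b)

⊕-option⁺ : ∀ P g h {c} → SumOption P g h c → c ∈ opts P (g ⊕ h)
⊕-option⁺ P g h (inˡ m) = subst (_ ∈_) (sym (opts-⊕ P g h)) (∈-++⁺ˡ (∈-map⁺ _ m))
⊕-option⁺ P g h (inʳ m) = subst (_ ∈_) (sym (opts-⊕ P g h)) (∈-++⁺ʳ _ (∈-map⁺ _ m))

⊕-option⁻ : ∀ P g h {c} → c ∈ opts P (g ⊕ h) → SumOption P g h c
⊕-option⁻ P g h m with ∈-++⁻ (map (_⊕ h) (opts P g)) (subst (_ ∈_) (opts-⊕ P g h) m)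
... | inj₁ m′ with ∈-map⁻ _ m′
...   | (a , ma , refl) = inˡ ma
⊕-option⁻ P g h m | inj₂ m′ with ∈-map⁻ _ m′
...   | (b , mb , refl) = inʳ mb

mutual
  ⊕-monoˡ-≼-acc : ∀ {g h} k → Acc _⊏_ k → g ≼ h → g ⊕ k ≼ h ⊕ k
  ⊕-monoˡ-≼-acc {g} {h} k ak p =
    ≼-intro (λ m → ⊕-monoˡ-left k ak p (⊕-option⁻ Left g k m)) (λ m → ⊕-monoˡ-right k ak p (⊕-option⁻ Right h k m))

  ⊕-monoˡ-left : ∀ {g h c} k → Acc _⊏_ k → g ≼ h → SumOption Left g k c → c ◁ h ⊕ k
  ⊕-monoˡ-left k ak (≼-intro pl _) (inˡ m) = ⊕-monoˡ-◁-acc k ak (pl m)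
  ⊕-monoˡ-left {h = h} k (acc rs) p (inʳ m) =
    ◁-left (⊕-option⁺ Left h k (inʳ m)) (⊕-monoˡ-≼-acc _ (rs (option Left m)) p)

  ⊕-monoˡ-right : ∀ {g h c} k → Acc _⊏_ k → g ≼ h → SumOption Right h k c → g ⊕ k ◁ c
  ⊕-monoˡ-right k ak (≼-intro _ pr) (inˡ m) = ⊕-monoˡ-◁-acc k ak (pr m)
  ⊕-monoˡ-right {g = g} k (acc rs) p (inʳ m) =
    ◁-right (⊕-option⁺ Right g k (inʳ m)) (⊕-monoˡ-≼-acc _ (rs (option Right m)) p)

  ⊕-monoˡ-◁-acc : ∀ {g h} k → Acc _⊏_ k → g ◁ h → g ⊕ k ◁ h ⊕ k
  ⊕-monoˡ-◁-acc {g} {h} k ak (◁-left m q)  = ◁-left (⊕-option⁺ Left h k (inˡ m)) (⊕-monoˡ-≼-acc k ak q)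
  ⊕-monoˡ-◁-acc {g} {h} k ak (◁-right m q) = ◁-right (⊕-option⁺ Right g k (inˡ m)) (⊕-monoˡ-≼-acc k ak q)

⊕-monoˡ-≼ : ∀ {g h} k → g ≼ h → g ⊕ k ≼ h ⊕ k
⊕-monoˡ-≼ k = ⊕-monoˡ-≼-acc k (⊏-wellFounded k)

⊕-congˡ : ∀ {g g′} h → g ≃ g′ → g ⊕ h ≃ g′ ⊕ h
⊕-congˡ h (p , q) = ⊕-monoˡ-≼ h p , ⊕-monoˡ-≼ h q

mutual
  ⊕-comm-acc : ∀ g h → Acc _⊏_ g → Acc _⊏_ h → g ⊕ h ≃ h ⊕ g
  ⊕-comm-acc g h ag ah = ≃-intro λ P →
    (λ m → ⊕-comm-option ag ah (⊕-option⁻ P g h m)) ,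
    (λ m → let (d , md , e) = ⊕-comm-option ah ag (⊕-option⁻ P h g m) in d , md , ≃-sym e)

  ⊕-comm-option : ∀ {P g h c} → Acc _⊏_ g → Acc _⊏_ h → SumOption P g h c → ∃[ d ] (d ∈ opts P (h ⊕ g) × c ≃ d)
  ⊕-comm-option {P} {g} {h} (acc rg) ah (inˡ m) = _ , ⊕-option⁺ P h g (inʳ m) , ⊕-comm-acc _ _ (rg (option P m)) ah
  ⊕-comm-option {P} {g} {h} ag (acc rh) (inʳ m) = _ , ⊕-option⁺ P h g (inˡ m) , ⊕-comm-acc _ _ ag (rh (option P m))

⊕-comm : ∀ g h → g ⊕ h ≃ h ⊕ g
⊕-comm g h = ⊕-comm-acc g h (⊏-wellFounded g) (⊏-wellFounded h)

⊕-congʳ : ∀ g {h h′} → h ≃ h′ → g ⊕ h ≃ g ⊕ h′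
⊕-congʳ g {h} {h′} e = ⊕-comm g h ⟫ ⊕-congˡ g e ⟫ ⊕-comm h′ g

⊕-cong : ∀ {g g′ h h′} → g ≃ g′ → h ≃ h′ → g ⊕ h ≃ g′ ⊕ h′
⊕-cong {g′ = g′} {h} e f = ⊕-congˡ h e ⟫ ⊕-congʳ g′ f

⊕-assoc-acc : ∀ g h k → Acc _⊏_ g → Acc _⊏_ h → Acc _⊏_ k → (g ⊕ h) ⊕ k ≃ g ⊕ (h ⊕ k)
⊕-assoc-acc g h k ag@(acc rg) ah@(acc rh) ak@(acc rk) =
  ≃-intro λ P → (λ m → forward (⊕-option⁻ P (g ⊕ h) k m)) , (λ m → backward (⊕-option⁻ P g (h ⊕ k) m))
  where
  forward : ∀ {P c} → SumOption P (g ⊕ h) k c → ∃[ d ] (d ∈ opts P (g ⊕ (h ⊕ k)) × c ≃ d)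
  forward {P} (inˡ m) with ⊕-option⁻ P g h m
  ... | inˡ m′ = _ , ⊕-option⁺ P g (h ⊕ k) (inˡ m′) , ⊕-assoc-acc _ h k (rg (option P m′)) ah ak
  ... | inʳ m′ = _ , ⊕-option⁺ P g (h ⊕ k) (inʳ (⊕-option⁺ P h k (inˡ m′))) , ⊕-assoc-acc g _ k ag (rh (option P m′)) ak
  forward {P} (inʳ m) =
    _ , ⊕-option⁺ P g (h ⊕ k) (inʳ (⊕-option⁺ P h k (inʳ m))) , ⊕-assoc-acc g h _ ag ah (rk (option P m))
  backward : ∀ {P c} → SumOption P g (h ⊕ k) c → ∃[ d ] (d ∈ opts P ((g ⊕ h) ⊕ k) × d ≃ c)
  backward {P} (inˡ m) =
    _ , ⊕-option⁺ P (g ⊕ h) k (inˡ (⊕-option⁺ P g h (inˡ m))) , ⊕-assoc-acc _ h k (rg (option P m)) ah ak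
  backward {P} (inʳ m) with ⊕-option⁻ P h k m
  ... | inˡ m′ = _ , ⊕-option⁺ P (g ⊕ h) k (inˡ (⊕-option⁺ P g h (inʳ m′))) , ⊕-assoc-acc g _ k ag (rh (option P m′)) ak
  ... | inʳ m′ = _ , ⊕-option⁺ P (g ⊕ h) k (inʳ m′) , ⊕-assoc-acc g h _ ag ah (rk (option P m′))

⊕-assoc : ∀ g h k → (g ⊕ h) ⊕ k ≃ g ⊕ (h ⊕ k)
⊕-assoc g h k = ⊕-assoc-acc g h k (⊏-wellFounded g) (⊏-wellFounded h) (⊏-wellFounded k)

zeroG : Game
zeroG = mk [] []

⊕-identityˡ-acc : ∀ g → Acc _⊏_ g → zeroG ⊕ g ≃ g
⊕-identityˡ-acc g (acc rg) = ≃-intro λ P →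
  (λ m → forward (⊕-option⁻ P zeroG g m)) ,
  (λ m → _ , ⊕-option⁺ P zeroG g (inʳ m) , ⊕-identityˡ-acc _ (rg (option P m)))
  where
  forward : ∀ {P c} → SumOption P zeroG g c → ∃[ d ] (d ∈ opts P g × c ≃ d)
  forward {Left}  (inˡ ())
  forward {Right} (inˡ ())
  forward {P}     (inʳ m) = _ , m , ⊕-identityˡ-acc _ (rg (option P m))

⊕-identityˡ : ∀ g → zeroG ⊕ g ≃ g
⊕-identityˡ g = ⊕-identityˡ-acc g (⊏-wellFounded g)

opponent : Player → Player
opponent Left  = Right
opponent Right = Left

mutual
  neg : Game → Game
  neg (mk L R) = mk (negs R) (negs L)

  negs : List Game → List Game
  negs []       = []
  negs (g ∷ gs) = neg g ∷ negs gs

negs≡map : ∀ gs → negs gs ≡ map neg gs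
negs≡map []       = refl
negs≡map (g ∷ gs) = cong (neg g ∷_) (negs≡map gs)

opts-neg : ∀ P g → opts P (neg g) ≡ map neg (opts (opponent P) g)
opts-neg Left  (mk L R) = negs≡map R
opts-neg Right (mk L R) = negs≡map L

neg-option⁺ : ∀ {P g a} → a ∈ opts (opponent P) g → neg a ∈ opts P (neg g)
neg-option⁺ {P} {g} m = subst (_ ∈_) (sym (opts-neg P g)) (∈-map⁺ neg m)

neg-option⁻ : ∀ {P g c} → c ∈ opts P (neg g) → ∃[ a ] (a ∈ opts (opponent P) g × c ≡ neg a)
neg-option⁻ {P} {g} m = ∈-map⁻ neg (subst (_ ∈_) (opts-neg P g) m)

⊕-inverseʳ-acc : ∀ g → Acc _⊏_ g → g ⊕ neg g ≃ zeroG
⊕-inverseʳ-acc g (acc rg) =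
  ≼-intro (λ m → left (⊕-option⁻ Left g (neg g) m)) (λ ()) , ≼-intro (λ ()) (λ m → right (⊕-option⁻ Right g (neg g) m))
  where
  -- Every move is answered by the mirror move in the other component.
  left : ∀ {c} → SumOption Left g (neg g) c → c ◁ zeroG
  left (inˡ {a} m) = ◁-right (⊕-option⁺ Right a (neg g) (inʳ (neg-option⁺ {Right} {g} m))) (proj₁ (⊕-inverseʳ-acc a (rg (option Left m))))
  left (inʳ m) with neg-option⁻ {Left} {g} m
  ... | (a , m′ , refl) = ◁-right (⊕-option⁺ Right g (neg a) (inˡ m′)) (proj₁ (⊕-inverseʳ-acc a (rg (option Right m′))))
  right : ∀ {c} → SumOption Right g (neg g) c → zeroG ◁ c
  right (inˡ {a} m) = ◁-left (⊕-option⁺ Left a (neg g) (inʳ (neg-option⁺ {Left} {g} m))) (proj₂ (⊕-inverseʳ-acc a (rg (option Right m))))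
  right (inʳ m) with neg-option⁻ {Right} {g} m
  ... | (a , m′ , refl) = ◁-left (⊕-option⁺ Left g (neg a) (inˡ m′)) (proj₂ (⊕-inverseʳ-acc a (rg (option Left m′))))

⊕-inverseʳ : ∀ g → g ⊕ neg g ≃ zeroG
⊕-inverseʳ g = ⊕-inverseʳ-acc g (⊏-wellFounded g)

mutual
  leftSecond-sound : ∀ g → T (leftSecond g) → zeroG ≼ g
  leftSecond-sound (mk L R) t = ≼-intro (λ ()) (allLeftFirst-sound R t)

  allLeftFirst-sound : ∀ gs → T (allLeftFirst gs) → ∀ {b} → b ∈ gs → zeroG ◁ b
  allLeftFirst-sound (g ∷ gs) t (here refl) = leftFirst-sound g (proj₁ (to (T-∧ {leftFirst g}) t))
  allLeftFirst-sound (g ∷ gs) t (there m)   = allLeftFirst-sound gs (proj₂ (to (T-∧ {leftFirst g}) t)) m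

  leftFirst-sound : ∀ g → T (leftFirst g) → zeroG ◁ g
  leftFirst-sound (mk L R) t = let (a , m , p) = anyLeftSecond-sound L t in ◁-left m p

  anyLeftSecond-sound : ∀ gs → T (anyLeftSecond gs) → ∃[ a ] (a ∈ gs × zeroG ≼ a)
  anyLeftSecond-sound (g ∷ gs) t with to (T-∨ {leftSecond g}) t
  ... | inj₁ t′ = g , here refl , leftSecond-sound g t′
  ... | inj₂ t′ = let (a , m , p) = anyLeftSecond-sound gs t′ in a , there m , p

mutual
  leftSecond-complete : ∀ g → zeroG ≼ g → T (leftSecond g)
  leftSecond-complete (mk L R) (≼-intro _ pr) = allLeftFirst-complete R pr

  allLeftFirst-complete : ∀ gs → (∀ {b} → b ∈ gs → zeroG ◁ b) → T (allLeftFirst gs)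
  allLeftFirst-complete []       _ = _
  allLeftFirst-complete (g ∷ gs) p =
    from T-∧ (leftFirst-complete g (p (here refl)) , allLeftFirst-complete gs (λ m → p (there m)))

  leftFirst-complete : ∀ g → zeroG ◁ g → T (leftFirst g)
  leftFirst-complete (mk L R) (◁-left m q) = anyLeftSecond-complete L m q
  leftFirst-complete (mk L R) (◁-right () _)

  anyLeftSecond-complete : ∀ gs {a} → a ∈ gs → zeroG ≼ a → T (anyLeftSecond gs)
  anyLeftSecond-complete (g ∷ gs) (here refl) q = from T-∨ (inj₁ (leftSecond-complete g q))
  anyLeftSecond-complete (g ∷ gs) (there m)   q = from (T-∨ {leftSecond g}) (inj₂ (anyLeftSecond-complete gs m q))

mutual
  rightSecond-sound : ∀ g → T (rightSecond g) → g ≼ zeroG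
  rightSecond-sound (mk L R) t = ≼-intro (allRightFirst-sound L t) (λ ())

  allRightFirst-sound : ∀ gs → T (allRightFirst gs) → ∀ {a} → a ∈ gs → a ◁ zeroG
  allRightFirst-sound (g ∷ gs) t (here refl) = rightFirst-sound g (proj₁ (to (T-∧ {rightFirst g}) t))
  allRightFirst-sound (g ∷ gs) t (there m)   = allRightFirst-sound gs (proj₂ (to (T-∧ {rightFirst g}) t)) m

  rightFirst-sound : ∀ g → T (rightFirst g) → g ◁ zeroG
  rightFirst-sound (mk L R) t = let (a , m , p) = anyRightSecond-sound R t in ◁-right m p

  anyRightSecond-sound : ∀ gs → T (anyRightSecond gs) → ∃[ a ] (a ∈ gs × a ≼ zeroG)
  anyRightSecond-sound (g ∷ gs) t with to (T-∨ {rightSecond g}) t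
  ... | inj₁ t′ = g , here refl , rightSecond-sound g t′
  ... | inj₂ t′ = let (a , m , p) = anyRightSecond-sound gs t′ in a , there m , p

mutual
  rightSecond-complete : ∀ g → g ≼ zeroG → T (rightSecond g)
  rightSecond-complete (mk L R) (≼-intro pl _) = allRightFirst-complete L pl

  allRightFirst-complete : ∀ gs → (∀ {a} → a ∈ gs → a ◁ zeroG) → T (allRightFirst gs)
  allRightFirst-complete []       _ = _
  allRightFirst-complete (g ∷ gs) p =
    from T-∧ (rightFirst-complete g (p (here refl)) , allRightFirst-complete gs (λ m → p (there m)))

  rightFirst-complete : ∀ g → g ◁ zeroG → T (rightFirst g)
  rightFirst-complete (mk L R) (◁-right m q) = anyRightSecond-complete R m q
  rightFirst-complete (mk L R) (◁-left () _)

  anyRightSecond-complete : ∀ gs {a} → a ∈ gs → a ≼ zeroG → T (anyRightSecond gs)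
  anyRightSecond-complete (g ∷ gs) (here refl) q = from T-∨ (inj₁ (rightSecond-complete g q))
  anyRightSecond-complete (g ∷ gs) (there m)   q = from (T-∨ {rightSecond g}) (inj₂ (anyRightSecond-complete gs m q))

T-injective : ∀ {a b} → (T a → T b) → (T b → T a) → a ≡ b
T-injective {false} {false} _ _ = refl
T-injective {false} {true}  _ f = ⊥-elim (f _)
T-injective {true}  {false} f _ = ⊥-elim (f _)
T-injective {true}  {true}  _ _ = refl

-- Left wins moving first in g ⊕ k iff 0 ◁ g ⊕ k, and Right iff g ⊕ k ◁ 0; both are invariant under g ≃ h.
≃⇒≈G : ∀ {g h} → g ≃ h → g ≈G h
≃⇒≈G {g} {h} (p , q) k = cong₂ _,_
  (T-injective (λ t → leftFirst-complete (h ⊕ k) (◁-≼-trans (leftFirst-sound (g ⊕ k) t) (⊕-monoˡ-≼ k p)))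
               (λ t → leftFirst-complete (g ⊕ k) (◁-≼-trans (leftFirst-sound (h ⊕ k) t) (⊕-monoˡ-≼ k q))))
  (T-injective (λ t → rightFirst-complete (h ⊕ k) (≼-◁-trans (⊕-monoˡ-≼ k q) (rightFirst-sound (g ⊕ k) t)))
               (λ t → rightFirst-complete (g ⊕ k) (≼-◁-trans (⊕-monoˡ-≼ k p) (rightFirst-sound (h ⊕ k) t))))

-- Clobber positions as games

stones-++ : ∀ A B → stones (A ++ B) ≡ stones A + stones B
stones-++ A B = trans (cong sum (map-++ length A B)) (sum-++ (map length A) (map length B))

stones-nonEmpty : ∀ ps → stones (nonEmpty ps) ≡ stones ps
stones-nonEmpty []             = refl
stones-nonEmpty ([] ∷ ps)      = stones-nonEmpty ps
stones-nonEmpty ((s ∷ p) ∷ ps) = cong (length (s ∷ p) +_) (stones-nonEmpty ps)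

splits-sound : ∀ p {pre a b suf} → (pre , a , b , suf) ∈ splits p → p ≡ pre ++ a ∷ b ∷ suf
splits-sound (a ∷ b ∷ r) (here refl) = refl
splits-sound (c ∷ d ∷ r) (there m) with ∈-map⁻ _ m
... | (_ , m′ , refl) = cong (c ∷_) (splits-sound (d ∷ r) m′)

splits-complete : ∀ pre a b suf → (pre , a , b , suf) ∈ splits (pre ++ a ∷ b ∷ suf)
splits-complete []            a b suf = here refl
splits-complete (c ∷ [])      a b suf = there (∈-map⁺ _ (splits-complete [] a b suf))
splits-complete (c ∷ d ∷ pre) a b suf = there (∈-map⁺ _ (splits-complete (d ∷ pre) a b suf))

data PartMove (P : Player) : Part → Part → Part → Set where
  captureʳ : ∀ pre suf → PartMove P (pre ++ stoneOf P ∷ negStone (stoneOf P) ∷ suf) pre (stoneOf P ∷ suf)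
  captureˡ : ∀ pre suf → PartMove P (pre ++ negStone (stoneOf P) ∷ stoneOf P ∷ suf) (pre ++ [ stoneOf P ]) suf

movePair-sound : ∀ P pre a b suf {new} → new ∈ movePair P (pre , a , b , suf) →
  ∃[ l ] ∃[ r ] (PartMove P (pre ++ a ∷ b ∷ suf) l r × new ≡ nonEmpty (l ∷ r ∷ []))
movePair-sound Left  pre x o suf (here refl) = _ , _ , captureʳ pre suf , refl
movePair-sound Left  pre o x suf (here refl) = _ , _ , captureˡ pre suf , refl
movePair-sound Right pre o x suf (here refl) = _ , _ , captureʳ pre suf , refl
movePair-sound Right pre x o suf (here refl) = _ , _ , captureˡ pre suf , refl
movePair-sound Left  pre x o suf (there ())
movePair-sound Left  pre o x suf (there ())
movePair-sound Right pre o x suf (there ())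
movePair-sound Right pre x o suf (there ())
movePair-sound Left  pre x x suf ()
movePair-sound Left  pre o o suf ()
movePair-sound Right pre x x suf ()
movePair-sound Right pre o o suf ()

partMoves-sound : ∀ {P p new} → new ∈ partMoves P p →
  ∃[ l ] ∃[ r ] (PartMove P p l r × new ≡ nonEmpty (l ∷ r ∷ []))
partMoves-sound {P} {p} m with find (∈-concatMap⁻ (movePair P) {xs = splits p} m)
... | ((pre , a , b , suf) , ms , mm) rewrite splits-sound p ms = movePair-sound P pre a b suf mm

movePair⊆partMoves : ∀ {P} pre a b suf {new} → new ∈ movePair P (pre , a , b , suf) →
  new ∈ partMoves P (pre ++ a ∷ b ∷ suf)
movePair⊆partMoves {P} pre a b suf m = ∈-concatMap⁺ (movePair P) (lose (splits-complete pre a b suf) m)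

partMoves-complete : ∀ {P p l r} → PartMove P p l r → nonEmpty (l ∷ r ∷ []) ∈ partMoves P p
partMoves-complete {Left}  (captureʳ pre suf) = movePair⊆partMoves pre x o suf (here refl)
partMoves-complete {Left}  (captureˡ pre suf) = movePair⊆partMoves pre o x suf (here refl)
partMoves-complete {Right} (captureʳ pre suf) = movePair⊆partMoves pre o x suf (here refl)
partMoves-complete {Right} (captureˡ pre suf) = movePair⊆partMoves pre x o suf (here refl)

PartMove-length : ∀ {P p l r} → PartMove P p l r → length p ≡ suc (length l + length r)
PartMove-length (captureʳ pre suf) = trans (length-++ pre) (+-suc (length pre) _)
PartMove-length {P} (captureˡ pre suf) = begin
  length (pre ++ negStone s ∷ s ∷ suf)     ≡⟨ length-++-sucʳ pre _ _ ⟩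
  suc (length (pre ++ s ∷ suf))            ≡⟨ cong (λ q → suc (length q)) (++-assoc pre [ s ] suf) ⟨
  suc (length ((pre ++ [ s ]) ++ suf))     ≡⟨ cong suc (length-++ (pre ++ [ s ])) ⟩
  suc (length (pre ++ [ s ]) + length suf) ∎
  where
  open ≡-Reasoning
  s = stoneOf P

reverse-middle : ∀ {A : Set} (pre : List A) a b suf → reverse (pre ++ a ∷ b ∷ suf) ≡ reverse suf ++ b ∷ a ∷ reverse pre
reverse-middle pre a b suf = begin
  reverse (pre ++ a ∷ b ∷ suf)               ≡⟨ reverse-++ pre (a ∷ b ∷ suf) ⟩
  reverse (a ∷ b ∷ suf) ++ reverse pre       ≡⟨ cong (_++ reverse pre) (reverse-++ (a ∷ b ∷ []) suf) ⟩
  (reverse suf ++ b ∷ a ∷ []) ++ reverse pre ≡⟨ ++-assoc (reverse suf) _ (reverse pre) ⟩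
  reverse suf ++ b ∷ a ∷ reverse pre         ∎
  where open ≡-Reasoning

PartMove-reverse : ∀ {P p l r} → PartMove P p l r → PartMove P (reverse p) (reverse r) (reverse l)
PartMove-reverse {P} (captureʳ pre suf) =
  subst₂ (λ q l′ → PartMove P q l′ (reverse pre)) (sym (reverse-middle pre _ _ suf)) (sym (unfold-reverse _ suf))
    (captureˡ (reverse suf) (reverse pre))
PartMove-reverse {P} (captureˡ pre suf) =
  subst₂ (λ q r′ → PartMove P q (reverse suf) r′) (sym (reverse-middle pre _ _ suf)) (sym (reverse-++ pre [ stoneOf P ]))
    (captureʳ (reverse suf) (reverse pre))

negPart-++ : ∀ A B → negPart (A ++ B) ≡ negPart A ++ negPart B
negPart-++ = map-++ negStone

PartMove-neg : ∀ {P p l r} → PartMove (opponent P) p l r → PartMove P (negPart p) (negPart l) (negPart r)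
PartMove-neg {Left} (captureʳ pre suf) =
  subst (λ q → PartMove Left q _ _) (sym (negPart-++ pre _)) (captureʳ (negPart pre) (negPart suf))
PartMove-neg {Right} (captureʳ pre suf) =
  subst (λ q → PartMove Right q _ _) (sym (negPart-++ pre _)) (captureʳ (negPart pre) (negPart suf))
PartMove-neg {Left} (captureˡ pre suf) =
  subst₂ (λ q l′ → PartMove Left q l′ _) (sym (negPart-++ pre _)) (sym (negPart-++ pre _)) (captureˡ (negPart pre) (negPart suf))
PartMove-neg {Right} (captureˡ pre suf) =
  subst₂ (λ q l′ → PartMove Right q l′ _) (sym (negPart-++ pre _)) (sym (negPart-++ pre _)) (captureˡ (negPart pre) (negPart suf))

partMove-stones : ∀ {P p new} → new ∈ partMoves P p → suc (stones new) ≡ length p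
partMove-stones {P} {p} m with partMoves-sound {P} {p} m
... | (l , r , mv , refl) = begin
  suc (stones (nonEmpty (l ∷ r ∷ []))) ≡⟨ cong suc (stones-nonEmpty (l ∷ r ∷ [])) ⟩
  suc (length l + (length r + 0))      ≡⟨ cong (λ n → suc (length l + n)) (+-identityʳ (length r)) ⟩
  suc (length l + length r)            ≡⟨ PartMove-length mv ⟨
  length p                             ∎
  where open ≡-Reasoning

data ∷Option (P : Player) (p : Part) (G : Position) : Position → Set where
  inPart : ∀ {new} → new ∈ partMoves P p → ∷Option P p G (new ++ G)
  inRest : ∀ {H} → H ∈ options P G → ∷Option P p G (p ∷ H)

options-∷ : ∀ P p G → options P (p ∷ G) ≡ map (_++ G) (partMoves P p) ++ map (p ∷_) (options P G)
options-∷ P p G = cong (map (_++ G) (partMoves P p) ++_) (begin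
  concatMap _ (map _ (picks G))        ≡⟨ concatMap-map _ _ (picks G) ⟩
  concatMap _ (picks G)                ≡⟨ concatMap-cong (λ { (pre , b , suf) → map-∘ (partMoves P b) }) (picks G) ⟩
  concatMap (map (p ∷_) ∘ _) (picks G) ≡⟨ map-concatMap (p ∷_) _ (picks G) ⟨
  map (p ∷_) (options P G)             ∎)
  where open ≡-Reasoning

options-∷⁺ : ∀ {P p G H} → ∷Option P p G H → H ∈ options P (p ∷ G)
options-∷⁺ {P} {p} {G} (inPart m) = subst (_ ∈_) (sym (options-∷ P p G)) (∈-++⁺ˡ (∈-map⁺ _ m))
options-∷⁺ {P} {p} {G} (inRest m) = subst (_ ∈_) (sym (options-∷ P p G)) (∈-++⁺ʳ _ (∈-map⁺ _ m))

options-∷⁻ : ∀ {P p G H} → H ∈ options P (p ∷ G) → ∷Option P p G H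
options-∷⁻ {P} {p} {G} m with ∈-++⁻ (map (_++ G) (partMoves P p)) (subst (_ ∈_) (options-∷ P p G) m)
... | inj₁ m′ with ∈-map⁻ _ m′
...   | (_ , mn , refl) = inPart mn
options-∷⁻ {P} {p} {G} m | inj₂ m′ with ∈-map⁻ _ m′
...   | (_ , mH , refl) = inRest mH

data ++Option (P : Player) (A B : Position) : Position → Set where
  inˡ : ∀ {A′} → A′ ∈ options P A → ++Option P A B (A′ ++ B)
  inʳ : ∀ {B′} → B′ ∈ options P B → ++Option P A B (A ++ B′)

options-++⁺ : ∀ {P} A {B H} → ++Option P A B H → H ∈ options P (A ++ B)
options-++⁺ []      (inʳ m) = m
options-++⁺ (p ∷ A) (inʳ m) = options-∷⁺ (inRest (options-++⁺ A (inʳ m)))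
options-++⁺ {P} (p ∷ A) {B} (inˡ m) with options-∷⁻ {P} {p} {A} m
... | inPart {new} mn = subst (_∈ options P (p ∷ A ++ B)) (sym (++-assoc new A B)) (options-∷⁺ (inPart mn))
... | inRest mH       = options-∷⁺ (inRest (options-++⁺ A (inˡ mH)))

options-++⁻ : ∀ {P} A {B H} → H ∈ options P (A ++ B) → ++Option P A B H
options-++⁻ []          m = inʳ m
options-++⁻ {P} (p ∷ A) {B} m with options-∷⁻ {P} {p} {A ++ B} m
... | inPart {new} mn = subst (++Option P (p ∷ A) B) (++-assoc new A B) (inˡ (options-∷⁺ (inPart mn)))
... | inRest mH with options-++⁻ A mH
...   | inˡ mA = inˡ (options-∷⁺ (inRest mA))
...   | inʳ mB = inʳ mB

options-stones : ∀ {P} G {H} → H ∈ options P G → suc (stones H) ≡ stones G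
options-stones {P} (p ∷ G) m with options-∷⁻ {P} {p} {G} m
... | inPart {new} mn = trans (cong suc (stones-++ new G)) (cong (_+ stones G) (partMove-stones {P} {p} mn))
... | inRest {H} mH   = trans (sym (+-suc (length p) (stones H))) (cong (length p +_) (options-stones G mH))

options-< : ∀ {P} G {H} → H ∈ options P G → stones H < stones G
options-< G m = ≤-reflexive (options-stones G m)

≃-reflexive : ∀ {g h} → g ≡ h → g ≃ h
≃-reflexive refl = ≃-refl

opts-toGame : ∀ P G → opts P (toGame G) ≡ map (toGameF (stones G)) (options P G)
opts-toGame Left  G = refl
opts-toGame Right G = refl

-- The fuel of toGame is exact: an option H of G has suc (stones H) = stones G.
toGame-option⁺ : ∀ {P G H} → H ∈ options P G → toGame H ∈ opts P (toGame G)
toGame-option⁺ {P} {G} {H} m = subst (_ ∈_) (sym (opts-toGame P G))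
  (subst (λ n → toGameF n H ∈ map (toGameF (stones G)) (options P G)) (sym (options-stones G m)) (∈-map⁺ _ m))

toGame-option⁻ : ∀ {P G c} → c ∈ opts P (toGame G) → ∃[ H ] (H ∈ options P G × c ≡ toGame H)
toGame-option⁻ {P} {G} m with ∈-map⁻ _ (subst (_ ∈_) (opts-toGame P G) m)
... | (H , mH , refl) = H , mH , cong (λ n → toGameF n H) (sym (options-stones G mH))

toGame-≃-intro : ∀ {G g} →
  (∀ P {H} → H ∈ options P G → ∃[ b ] (b ∈ opts P g × toGame H ≃ b)) →
  (∀ P {b} → b ∈ opts P g → ∃[ H ] (H ∈ options P G × toGame H ≃ b)) → toGame G ≃ g
toGame-≃-intro {G} {g} forth back = ≃-intro λ P →
  (λ m → let (H , mH , e) = toGame-option⁻ {P} {G} m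
             (b , mb , e′) = forth P mH
         in b , mb , subst (_≃ b) (sym e) e′) ,
  (λ m → let (H , mH , e) = back P m in toGame H , toGame-option⁺ {P} {G} mH , e)

toGame-++-acc : ∀ A B → Acc _<_ (stones (A ++ B)) → toGame (A ++ B) ≃ toGame A ⊕ toGame B
toGame-++-acc A B (acc rs) = toGame-≃-intro {A ++ B} forth back
  where
  forth : ∀ P {H} → H ∈ options P (A ++ B) → ∃[ b ] (b ∈ opts P (toGame A ⊕ toGame B) × toGame H ≃ b)
  forth P m with options-++⁻ A m
  ... | inˡ {A′} mA = toGame A′ ⊕ toGame B , ⊕-option⁺ P (toGame A) (toGame B) (inˡ (toGame-option⁺ {P} {A} mA)) ,
                      toGame-++-acc A′ B (rs (options-< (A ++ B) m))
  ... | inʳ {B′} mB = toGame A ⊕ toGame B′ , ⊕-option⁺ P (toGame A) (toGame B) (inʳ (toGame-option⁺ {P} {B} mB)) ,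
                      toGame-++-acc A B′ (rs (options-< (A ++ B) m))
  back : ∀ P {b} → b ∈ opts P (toGame A ⊕ toGame B) → ∃[ H ] (H ∈ options P (A ++ B) × toGame H ≃ b)
  back P m with ⊕-option⁻ P (toGame A) (toGame B) m
  ... | inˡ ma with toGame-option⁻ {P} {A} ma
  ...   | (A′ , mA , refl) = A′ ++ B , mH , toGame-++-acc A′ B (rs (options-< (A ++ B) mH))
    where mH = options-++⁺ A (inˡ mA)
  back P m | inʳ mb with toGame-option⁻ {P} {B} mb
  ...   | (B′ , mB , refl) = A ++ B′ , mH , toGame-++-acc A B′ (rs (options-< (A ++ B) mH))
    where mH = options-++⁺ A (inʳ mB)

toGame-++ : ∀ A B → toGame (A ++ B) ≃ toGame A ⊕ toGame B
toGame-++ A B = toGame-++-acc A B (<-wellFounded _)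

toGame-∷ : ∀ p G → toGame (p ∷ G) ≃ toGame [ p ] ⊕ toGame G
toGame-∷ p = toGame-++ [ p ]

toGame-∷-congʳ : ∀ p {G H} → toGame G ≃ toGame H → toGame (p ∷ G) ≃ toGame (p ∷ H)
toGame-∷-congʳ p {G} {H} e = toGame-∷ p G ⟫ ⊕-congʳ _ e ⟫ ≃-sym (toGame-∷ p H)

toGame-swap : ∀ p q G → toGame (p ∷ q ∷ G) ≃ toGame (q ∷ p ∷ G)
toGame-swap p q G =
  toGame-∷ p (q ∷ G) ⟫ ⊕-congʳ gp (toGame-∷ q G) ⟫ ≃-sym (⊕-assoc gp gq gG) ⟫ ⊕-congˡ gG (⊕-comm gp gq) ⟫
  ⊕-assoc gq gp gG ⟫ ⊕-congʳ gq (≃-sym (toGame-∷ p G)) ⟫ ≃-sym (toGame-∷ q (p ∷ G))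
  where
  gp = toGame [ p ]
  gq = toGame [ q ]
  gG = toGame G

toGame-↭ : ∀ {G H} → G ↭ H → toGame G ≃ toGame H
toGame-↭ Perm.refl          = ≃-refl
toGame-↭ (Perm.prep p π)    = toGame-∷-congʳ p (toGame-↭ π)
toGame-↭ (Perm.swap p q π)  = toGame-swap p q _ ⟫ toGame-∷-congʳ q (toGame-∷-congʳ p (toGame-↭ π))
toGame-↭ (Perm.trans π π′) = toGame-↭ π ⟫ toGame-↭ π′

toGame-nonEmpty : ∀ ps → toGame (nonEmpty ps) ≃ toGame ps
toGame-nonEmpty []             = ≃-refl
toGame-nonEmpty ([] ∷ ps)      = toGame-nonEmpty ps ⟫ ≃-sym (toGame-∷ [] ps ⟫ ⊕-identityˡ (toGame ps))
toGame-nonEmpty ((s ∷ p) ∷ ps) = toGame-∷-congʳ (s ∷ p) (toGame-nonEmpty ps)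

pieces : Part → Part → Position
pieces l r = nonEmpty (l ∷ r ∷ []) ++ []

toGame-pieces : ∀ l r → toGame (pieces l r) ≃ toGame [ l ] ⊕ toGame [ r ]
toGame-pieces l r = ≃-reflexive (cong toGame (++-identityʳ (nonEmpty (l ∷ r ∷ [])))) ⟫ toGame-nonEmpty (l ∷ r ∷ []) ⟫ toGame-∷ l [ r ]

partMove-option : ∀ {P p l r} → PartMove P p l r → pieces l r ∈ options P [ p ]
partMove-option {P} {p} mv = options-∷⁺ {P} {p} {[]} (inPart (partMoves-complete mv))

option-partMove : ∀ {P p H} → H ∈ options P [ p ] → ∃[ l ] ∃[ r ] (PartMove P p l r × H ≡ pieces l r)
option-partMove {P} {p} m with options-∷⁻ {P} {p} {[]} m
... | inPart mn with partMoves-sound {P} {p} mn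
...   | (l , r , mv , refl) = l , r , mv , refl

PartMove-<ˡ : ∀ {P p l r} → PartMove P p l r → length l < length p
PartMove-<ˡ {l = l} {r} mv = subst (length l <_) (sym (PartMove-length mv)) (s≤s (m≤m+n (length l) (length r)))

PartMove-<ʳ : ∀ {P p l r} → PartMove P p l r → length r < length p
PartMove-<ʳ {l = l} {r} mv = subst (length r <_) (sym (PartMove-length mv)) (s≤s (m≤n+m (length r) (length l)))

toGame-reverse-acc : ∀ p → Acc _<_ (length p) → toGame [ reverse p ] ≃ toGame [ p ]
toGame-reverse-acc p (acc rs) = toGame-≃-intro {[ reverse p ]} forth back
  where
  mirror : ∀ {P l r} → PartMove P p l r → toGame (pieces l r) ≃ toGame (pieces (reverse r) (reverse l))
  mirror {l = l} {r} mv =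
    toGame-pieces l r ⟫ ⊕-comm (toGame [ l ]) (toGame [ r ]) ⟫
    ⊕-cong (≃-sym (toGame-reverse-acc r (rs (PartMove-<ʳ mv)))) (≃-sym (toGame-reverse-acc l (rs (PartMove-<ˡ mv)))) ⟫
    ≃-sym (toGame-pieces (reverse r) (reverse l))
  forth : ∀ P {H} → H ∈ options P [ reverse p ] → ∃[ b ] (b ∈ opts P (toGame [ p ]) × toGame H ≃ b)
  forth P m with option-partMove {P} {reverse p} m
  ... | (l , r , mv , refl) =
    _ , toGame-option⁺ {P} {[ p ]} (partMove-option mv′) ,
    (≃-reflexive (cong toGame (sym (cong₂ pieces (reverse-involutive l) (reverse-involutive r)))) ⟫ ≃-sym (mirror mv′))
    where mv′ = subst (λ q → PartMove P q (reverse r) (reverse l)) (reverse-involutive p) (PartMove-reverse mv)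
  back : ∀ P {b} → b ∈ opts P (toGame [ p ]) → ∃[ H ] (H ∈ options P [ reverse p ] × toGame H ≃ b)
  back P m with toGame-option⁻ {P} {[ p ]} m
  ... | (H , mH , refl) with option-partMove mH
  ...   | (l , r , mv , refl) = _ , partMove-option (PartMove-reverse mv) , ≃-sym (mirror mv)

toGame-≅ : ∀ {p q} → p ≅ q → toGame [ p ] ≃ toGame [ q ]
toGame-≅ (inj₁ refl) = ≃-refl
toGame-≅ {q = q} (inj₂ refl) = toGame-reverse-acc q (<-wellFounded _)

negPart-nonEmpty : ∀ ps → map negPart (nonEmpty ps) ≡ nonEmpty (map negPart ps)
negPart-nonEmpty []             = refl
negPart-nonEmpty ([] ∷ ps)      = negPart-nonEmpty ps
negPart-nonEmpty ((s ∷ p) ∷ ps) = cong (negPart (s ∷ p) ∷_) (negPart-nonEmpty ps)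

negPart-involutive : ∀ p → negPart (negPart p) ≡ p
negPart-involutive []      = refl
negPart-involutive (x ∷ p) = cong (x ∷_) (negPart-involutive p)
negPart-involutive (o ∷ p) = cong (o ∷_) (negPart-involutive p)

map-negPart-involutive : ∀ G → map negPart (map negPart G) ≡ G
map-negPart-involutive []      = refl
map-negPart-involutive (p ∷ G) = cong₂ _∷_ (negPart-involutive p) (map-negPart-involutive G)

opponent-involutive : ∀ P → opponent (opponent P) ≡ P
opponent-involutive Left  = refl
opponent-involutive Right = refl

partMoves-neg : ∀ {P p new} → new ∈ partMoves (opponent P) p → map negPart new ∈ partMoves P (negPart p)
partMoves-neg {P} {p} m with partMoves-sound {opponent P} {p} m
... | (l , r , mv , refl) = subst (_∈ partMoves P (negPart p)) (sym (negPart-nonEmpty (l ∷ r ∷ [])))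
                                  (partMoves-complete (PartMove-neg mv))

options-neg⁺ : ∀ P G {H} → H ∈ options (opponent P) G → map negPart H ∈ options P (map negPart G)
options-neg⁺ P (p ∷ G) m with options-∷⁻ {opponent P} {p} {G} m
... | inPart {new} mn = subst (_∈ options P (map negPart (p ∷ G))) (sym (map-++ negPart new G))
                              (options-∷⁺ (inPart (partMoves-neg {P} {p} mn)))
... | inRest mH       = options-∷⁺ (inRest (options-neg⁺ P G mH))

options-neg⁻ : ∀ P G {K} → K ∈ options P (map negPart G) → ∃[ H ] (H ∈ options (opponent P) G × K ≡ map negPart H)
options-neg⁻ P G {K} m = map negPart K ,
  subst (λ G′ → map negPart K ∈ options (opponent P) G′) (map-negPart-involutive G)
    (options-neg⁺ (opponent P) (map negPart G) (subst (λ Q → K ∈ options Q (map negPart G)) (sym (opponent-involutive P)) m)) ,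
  sym (map-negPart-involutive K)

toGame-neg-acc : ∀ G → Acc _<_ (stones G) → toGame (map negPart G) ≃ neg (toGame G)
toGame-neg-acc G (acc rs) = toGame-≃-intro {map negPart G} forth back
  where
  forth : ∀ P {K} → K ∈ options P (map negPart G) → ∃[ b ] (b ∈ opts P (neg (toGame G)) × toGame K ≃ b)
  forth P m with options-neg⁻ P G m
  ... | (H , mH , refl) = neg (toGame H) , neg-option⁺ {P} {toGame G} (toGame-option⁺ {opponent P} {G} mH) ,
                          toGame-neg-acc H (rs (options-< G mH))
  back : ∀ P {b} → b ∈ opts P (neg (toGame G)) → ∃[ K ] (K ∈ options P (map negPart G) × toGame K ≃ b)
  back P m with neg-option⁻ {P} {toGame G} m
  ... | (a , ma , refl) with toGame-option⁻ {opponent P} {G} ma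
  ...   | (H , mH , refl) = map negPart H , options-neg⁺ P G mH , toGame-neg-acc H (rs (options-< G mH))

toGame-neg : ∀ G → toGame (map negPart G) ≃ neg (toGame G)
toGame-neg G = toGame-neg-acc G (<-wellFounded _)

toGame-cancel : ∀ p {q} G → q ≅ negPart p → toGame (p ∷ q ∷ G) ≃ toGame G
toGame-cancel p {q} G q≅-p =
  toGame-∷ p (q ∷ G) ⟫ ⊕-congʳ gp (toGame-∷ q G) ⟫ ≃-sym (⊕-assoc gp gq (toGame G)) ⟫
  ⊕-congˡ (toGame G) (⊕-congʳ gp (toGame-≅ q≅-p ⟫ toGame-neg [ p ]) ⟫ ⊕-inverseʳ gp) ⟫ ⊕-identityˡ (toGame G)
  where
  gp = toGame [ p ]
  gq = toGame [ q ]

toGame-replace : ∀ {p} rs G → toGame [ p ] ≃ toGame rs → toGame (p ∷ G) ≃ toGame (rs ++ G)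
toGame-replace {p} rs G e = toGame-∷ p G ⟫ ⊕-congˡ (toGame G) e ⟫ ≃-sym (toGame-++ rs G)

-- Certified evaluation of parts

mutual
  _≼ᵇ_ : Game → Game → Bool
  g@(mk GL GR) ≼ᵇ h@(mk HL HR) = allˡ◁ᵇ GL h ∧ allʳ◁ᵇ g HR

  _◁ᵇ_ : Game → Game → Bool
  g@(mk GL GR) ◁ᵇ h@(mk HL HR) = anyʳ≼ᵇ g HL ∨ anyˡ≼ᵇ GR h

  allˡ◁ᵇ : List Game → Game → Bool
  allˡ◁ᵇ []       h = true
  allˡ◁ᵇ (a ∷ as) h = (a ◁ᵇ h) ∧ allˡ◁ᵇ as h

  allʳ◁ᵇ : Game → List Game → Bool
  allʳ◁ᵇ g []       = true
  allʳ◁ᵇ g (b ∷ bs) = (g ◁ᵇ b) ∧ allʳ◁ᵇ g bs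

  anyʳ≼ᵇ : Game → List Game → Bool
  anyʳ≼ᵇ g []       = false
  anyʳ≼ᵇ g (a ∷ as) = (g ≼ᵇ a) ∨ anyʳ≼ᵇ g as

  anyˡ≼ᵇ : List Game → Game → Bool
  anyˡ≼ᵇ []       h = false
  anyˡ≼ᵇ (b ∷ bs) h = (b ≼ᵇ h) ∨ anyˡ≼ᵇ bs h

mutual
  ≼ᵇ-sound : ∀ g h → T (g ≼ᵇ h) → g ≼ h
  ≼ᵇ-sound g@(mk GL GR) h@(mk HL HR) t =
    let (tl , tr) = to (T-∧ {allˡ◁ᵇ GL h}) t in ≼-intro (allˡ◁ᵇ-sound GL h tl) (allʳ◁ᵇ-sound g HR tr)

  ◁ᵇ-sound : ∀ g h → T (g ◁ᵇ h) → g ◁ h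
  ◁ᵇ-sound g@(mk GL GR) h@(mk HL HR) t =
    [ (λ t′ → let (a , m , p) = anyʳ≼ᵇ-sound g HL t′ in ◁-left m p)
    , (λ t′ → let (b , m , p) = anyˡ≼ᵇ-sound GR h t′ in ◁-right m p)
    ]′ (to (T-∨ {anyʳ≼ᵇ g HL}) t)

  allˡ◁ᵇ-sound : ∀ as h → T (allˡ◁ᵇ as h) → ∀ {a} → a ∈ as → a ◁ h
  allˡ◁ᵇ-sound (a ∷ as) h t (here refl) = ◁ᵇ-sound a h (proj₁ (to (T-∧ {a ◁ᵇ h}) t))
  allˡ◁ᵇ-sound (a ∷ as) h t (there m)   = allˡ◁ᵇ-sound as h (proj₂ (to (T-∧ {a ◁ᵇ h}) t)) m

  allʳ◁ᵇ-sound : ∀ g bs → T (allʳ◁ᵇ g bs) → ∀ {b} → b ∈ bs → g ◁ b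
  allʳ◁ᵇ-sound g (b ∷ bs) t (here refl) = ◁ᵇ-sound g b (proj₁ (to (T-∧ {g ◁ᵇ b}) t))
  allʳ◁ᵇ-sound g (b ∷ bs) t (there m)   = allʳ◁ᵇ-sound g bs (proj₂ (to (T-∧ {g ◁ᵇ b}) t)) m

  anyʳ≼ᵇ-sound : ∀ g as → T (anyʳ≼ᵇ g as) → ∃[ a ] (a ∈ as × g ≼ a)
  anyʳ≼ᵇ-sound g (a ∷ as) t =
    [ (λ t′ → a , here refl , ≼ᵇ-sound g a t′)
    , (λ t′ → let (a′ , m , p) = anyʳ≼ᵇ-sound g as t′ in a′ , there m , p)
    ]′ (to (T-∨ {g ≼ᵇ a}) t)

  anyˡ≼ᵇ-sound : ∀ bs h → T (anyˡ≼ᵇ bs h) → ∃[ b ] (b ∈ bs × b ≼ h)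
  anyˡ≼ᵇ-sound (b ∷ bs) h t =
    [ (λ t′ → b , here refl , ≼ᵇ-sound b h t′)
    , (λ t′ → let (b′ , m , p) = anyˡ≼ᵇ-sound bs h t′ in b′ , there m , p)
    ]′ (to (T-∨ {b ≼ᵇ h}) t)

_≃ᵐ_ : Maybe Game → Maybe Game → Bool
just g ≃ᵐ just h = (g ≼ᵇ h) ∧ (h ≼ᵇ g)
_      ≃ᵐ _      = false

≃ᵐ-sound : ∀ {m n} → T (m ≃ᵐ n) → ∃[ g ] ∃[ h ] (m ≡ just g × n ≡ just h × g ≃ h)
≃ᵐ-sound {just g} {just h} t =
  let (p , q) = to (T-∧ {g ≼ᵇ h}) t in g , h , refl , refl , ≼ᵇ-sound g h p , ≼ᵇ-sound h g q

_≟ˢ_ : DecidableEquality Stone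
x ≟ˢ x = yes refl
o ≟ˢ o = yes refl
x ≟ˢ o = no λ ()
o ≟ˢ x = no λ ()

_≟ᵖ_ : DecidableEquality Part
_≟ᵖ_ = ≡-dec _≟ˢ_

ValueTable : Set
ValueTable = List (Part × Game)

SoundTable : ValueTable → Set
SoundTable = All (λ (p , v) → toGame [ p ] ≃ v)

lookupValue : ValueTable → Part → Maybe Game
lookupValue []              p = nothing
lookupValue ((q , v) ∷ tbl) p with p ≟ᵖ q
... | yes _ = just v
... | no  _ = lookupValue tbl p

lookupValue-sound : ∀ {tbl} → SoundTable tbl → ∀ p {v} → lookupValue tbl p ≡ just v → toGame [ p ] ≃ v
lookupValue-sound {(q , v) ∷ tbl} (e ∷ es) p eq with p ≟ᵖ q
lookupValue-sound {(q , v) ∷ tbl} (e ∷ es) p refl | yes refl = e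
lookupValue-sound {(q , v) ∷ tbl} (e ∷ es) p eq   | no _     = lookupValue-sound es p eq

valuePosition : ValueTable → Position → Maybe Game
valuePosition tbl []      = just zeroG
valuePosition tbl (p ∷ G) = zipWith _⊕_ (lookupValue tbl p) (valuePosition tbl G)

valuePosition-sound : ∀ {tbl} → SoundTable tbl → ∀ G {v} → valuePosition tbl G ≡ just v → toGame G ≃ v
valuePosition-sound sound []      refl = ≃-refl
valuePosition-sound {tbl} sound (p ∷ G) eq with lookupValue tbl p in e₁ | valuePosition tbl G in e₂
valuePosition-sound sound (p ∷ G) refl | just a | just b =
  toGame-∷ p G ⟫ ⊕-cong (lookupValue-sound sound p e₁) (valuePosition-sound sound G e₂)

valuePositions : ValueTable → List Position → Maybe (List Game)
valuePositions tbl []       = just []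
valuePositions tbl (G ∷ Gs) = zipWith _∷_ (valuePosition tbl G) (valuePositions tbl Gs)

valuePositions-sound : ∀ {tbl} → SoundTable tbl → ∀ Gs {vs} → valuePositions tbl Gs ≡ just vs →
  Pointwise (λ G v → toGame G ≃ v) Gs vs
valuePositions-sound sound []       refl = []
valuePositions-sound {tbl} sound (G ∷ Gs) eq with valuePosition tbl G in e₁ | valuePositions tbl Gs in e₂
valuePositions-sound sound (G ∷ Gs) refl | just v | just vs =
  valuePosition-sound sound G e₁ ∷ valuePositions-sound sound Gs e₂

pointwise-∈ˡ : ∀ {Gs vs H} → Pointwise (λ G v → toGame G ≃ v) Gs vs → H ∈ Gs → ∃[ v ] (v ∈ vs × toGame H ≃ v)
pointwise-∈ˡ (e ∷ es) (here refl) = _ , here refl , e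
pointwise-∈ˡ (e ∷ es) (there m)   = let (v , mv , e′) = pointwise-∈ˡ es m in v , there mv , e′

pointwise-∈ʳ : ∀ {Gs vs v} → Pointwise (λ G v → toGame G ≃ v) Gs vs → v ∈ vs → ∃[ H ] (H ∈ Gs × toGame H ≃ v)
pointwise-∈ʳ (e ∷ es) (here refl) = _ , here refl , e
pointwise-∈ʳ (e ∷ es) (there m)   = let (H , mH , e′) = pointwise-∈ʳ es m in H , there mH , e′

valueFromOptions : ValueTable → Part → Maybe Game
valueFromOptions tbl p = zipWith mk (valuePositions tbl (options Left [ p ])) (valuePositions tbl (options Right [ p ]))

valueFromOptions-sound : ∀ {tbl} → SoundTable tbl → ∀ p {v} → valueFromOptions tbl p ≡ just v → toGame [ p ] ≃ v
valueFromOptions-sound {tbl} sound p eq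
  with valuePositions tbl (options Left [ p ]) in e₁ | valuePositions tbl (options Right [ p ]) in e₂
valueFromOptions-sound {tbl} sound p refl | just vl | just vr =
  toGame-≃-intro {[ p ]} (λ P m → pointwise-∈ˡ (values P) m) (λ P m → pointwise-∈ʳ (values P) m)
  where
  values : ∀ P → Pointwise (λ G v → toGame G ≃ v) (options P [ p ]) (opts P (mk vl vr))
  values Left  = valuePositions-sound sound _ e₁
  values Right = valuePositions-sound sound _ e₂

-- Each entry is checked using only the entries after it.
checkTable : ValueTable → Bool
checkTable []              = true
checkTable ((p , v) ∷ tbl) = (valueFromOptions tbl p ≃ᵐ just v) ∧ checkTable tbl

checkTable-sound : ∀ tbl → T (checkTable tbl) → SoundTable tbl
checkTable-sound []              _ = []
checkTable-sound ((p , v) ∷ tbl) t with to (T-∧ {valueFromOptions tbl p ≃ᵐ just v}) t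
... | (t₁ , t₂) with ≃ᵐ-sound {valueFromOptions tbl p} t₁
...   | (g , _ , eq , refl , g≃v) = (valueFromOptions-sound (checkTable-sound tbl t₂) p eq ⟫ g≃v) ∷ checkTable-sound tbl t₂

gv0 : Game
gv0 = mk [] []

gv1 : Game
gv1 = mk (gv0 ∷ []) (gv0 ∷ [])

gv2 : Game
gv2 = mk (gv0 ∷ gv1 ∷ []) (gv0 ∷ [])

gv3 : Game
gv3 = mk (gv0 ∷ []) (gv0 ∷ gv1 ∷ [])

gv4 : Game
gv4 = mk (gv0 ∷ gv2 ∷ []) (gv0 ∷ gv3 ∷ [])

gv5 : Game
gv5 = mk (gv0 ∷ []) (gv1 ∷ [])

gv6 : Game
gv6 = mk (gv0 ∷ []) (gv5 ∷ [])

gv7 : Game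
gv7 = mk (gv1 ∷ []) (gv0 ∷ [])

gv8 : Game
gv8 = mk (gv1 ∷ gv5 ∷ []) (gv3 ∷ gv7 ∷ [])

gv9 : Game
gv9 = mk (gv5 ∷ gv6 ∷ []) (gv0 ∷ gv1 ∷ gv8 ∷ [])

gv10 : Game
gv10 = mk (gv1 ∷ gv5 ∷ []) (gv1 ∷ gv7 ∷ [])

gv11 : Game
gv11 = mk (gv7 ∷ []) (gv0 ∷ [])

gv12 : Game
gv12 = mk (gv1 ∷ gv10 ∷ gv7 ∷ []) (gv11 ∷ gv7 ∷ [])

gv13 : Game
gv13 = mk (gv11 ∷ []) (gv0 ∷ [])

gv14 : Game
gv14 = mk (gv1 ∷ gv12 ∷ []) (gv13 ∷ [])

gv15 : Game
gv15 = mk (gv3 ∷ []) (gv0 ∷ [])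

gv16 : Game
gv16 = mk (gv3 ∷ []) (gv15 ∷ [])

gv17 : Game
gv17 = mk (gv0 ∷ gv1 ∷ gv9 ∷ []) (gv14 ∷ gv16 ∷ [])

gv18 : Game
gv18 = mk (gv0 ∷ []) (gv6 ∷ [])

gv19 : Game
gv19 = mk (gv5 ∷ gv6 ∷ []) (gv1 ∷ gv10 ∷ gv5 ∷ [])

gv20 : Game
gv20 = mk (gv18 ∷ []) (gv1 ∷ gv19 ∷ [])

gv21 : Game
gv21 = mk (gv0 ∷ []) (gv2 ∷ [])

gv22 : Game
gv22 = mk (gv21 ∷ []) (gv2 ∷ [])

gv23 : Game
gv23 = mk (gv2 ∷ gv5 ∷ []) (gv1 ∷ gv7 ∷ [])

gv24 : Game
gv24 = mk (gv0 ∷ gv1 ∷ gv23 ∷ []) (gv11 ∷ gv7 ∷ [])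

gv25 : Game
gv25 = mk (gv20 ∷ gv22 ∷ []) (gv0 ∷ gv1 ∷ gv24 ∷ [])

gv26 : Game
gv26 = mk (gv0 ∷ []) (gv2 ∷ gv4 ∷ [])

gv27 : Game
gv27 = mk (gv5 ∷ []) (gv1 ∷ [])

gv28 : Game
gv28 = mk (gv2 ∷ gv5 ∷ []) (gv0 ∷ gv3 ∷ [])

gv29 : Game
gv29 = mk (gv21 ∷ gv6 ∷ []) (gv0 ∷ gv2 ∷ gv28 ∷ [])

gv30 : Game
gv30 = mk (gv0 ∷ gv3 ∷ gv4 ∷ []) (gv15 ∷ gv3 ∷ [])

gv31 : Game
gv31 = mk (gv26 ∷ gv27 ∷ gv29 ∷ []) (gv0 ∷ gv30 ∷ [])

gv32 : Game
gv32 = mk (gv19 ∷ gv6 ∷ []) (gv11 ∷ gv12 ∷ [])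

gv33 : Game
gv33 = mk (gv0 ∷ []) (gv10 ∷ gv5 ∷ [])

gv34 : Game
gv34 = mk (gv0 ∷ gv1 ∷ []) (gv7 ∷ [])

gv35 : Game
gv35 = mk (gv6 ∷ []) (gv10 ∷ gv7 ∷ [])

gv36 : Game
gv36 = mk (gv10 ∷ gv5 ∷ []) (gv11 ∷ [])

gv37 : Game
gv37 = mk (gv5 ∷ []) (gv0 ∷ gv1 ∷ [])

gv38 : Game
gv38 = mk (gv10 ∷ gv7 ∷ []) (gv0 ∷ [])

gv39 : Game
gv39 = mk (gv33 ∷ gv34 ∷ gv35 ∷ gv5 ∷ []) (gv36 ∷ gv37 ∷ gv38 ∷ gv7 ∷ [])

gv40 : Game
gv40 = mk (gv2 ∷ gv21 ∷ []) (gv0 ∷ gv2 ∷ gv4 ∷ [])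

gv41 : Game
gv41 = mk (gv1 ∷ []) (gv7 ∷ [])

gv42 : Game
gv42 = mk (gv0 ∷ gv2 ∷ []) (gv3 ∷ gv7 ∷ [])

gv43 : Game
gv43 = mk (gv0 ∷ gv3 ∷ gv42 ∷ []) (gv11 ∷ gv15 ∷ [])

gv44 : Game
gv44 = mk (gv3 ∷ gv4 ∷ []) (gv0 ∷ [])

gv45 : Game
gv45 = mk (gv0 ∷ gv40 ∷ []) (gv41 ∷ gv43 ∷ gv44 ∷ [])

gv46 : Game
gv46 = mk (gv2 ∷ gv28 ∷ []) (gv15 ∷ [])

gv47 : Game
gv47 = mk (gv0 ∷ gv1 ∷ gv23 ∷ []) (gv3 ∷ gv41 ∷ [])

gv48 : Game
gv48 = mk (gv2 ∷ gv27 ∷ []) (gv0 ∷ gv1 ∷ gv8 ∷ [])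

gv49 : Game
gv49 = mk (gv21 ∷ []) (gv3 ∷ gv42 ∷ [])

gv50 : Game
gv50 = mk (gv6 ∷ []) (gv3 ∷ [])

gv51 : Game
gv51 = mk (gv2 ∷ gv5 ∷ []) (gv3 ∷ gv7 ∷ [])

gv52 : Game
gv52 = mk (gv27 ∷ gv40 ∷ []) (gv30 ∷ gv41 ∷ [])

gv53 : Game
gv53 = mk (gv2 ∷ []) (gv11 ∷ [])

gv54 : Game
gv54 = mk (gv2 ∷ gv4 ∷ []) (gv15 ∷ [])

gv55 : Game
gv55 = mk (gv21 ∷ []) (gv3 ∷ gv4 ∷ [])

-- Canonical values of the parts needed by the rules, longest parts first.
table : ValueTable
table =
  ((o ∷ x ∷ o ∷ x ∷ o ∷ x ∷ o ∷ x ∷ o ∷ x ∷ o ∷ x ∷ []) , gv4) ∷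
  ((x ∷ o ∷ x ∷ o ∷ x ∷ o ∷ x ∷ o ∷ x ∷ o ∷ x ∷ o ∷ []) , gv4) ∷
  ((o ∷ o ∷ x ∷ o ∷ x ∷ o ∷ x ∷ o ∷ x ∷ o ∷ x ∷ []) , gv17) ∷
  ((o ∷ x ∷ o ∷ x ∷ o ∷ x ∷ o ∷ x ∷ o ∷ x ∷ x ∷ []) , gv25) ∷
  ((x ∷ o ∷ x ∷ o ∷ x ∷ o ∷ x ∷ o ∷ x ∷ o ∷ o ∷ []) , gv17) ∷
  ((x ∷ x ∷ o ∷ x ∷ o ∷ x ∷ o ∷ x ∷ o ∷ x ∷ o ∷ []) , gv25) ∷
  ((o ∷ o ∷ x ∷ o ∷ x ∷ o ∷ x ∷ o ∷ x ∷ o ∷ []) , gv31) ∷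
  ((o ∷ o ∷ x ∷ o ∷ x ∷ o ∷ x ∷ o ∷ x ∷ x ∷ []) , gv32) ∷
  ((o ∷ x ∷ o ∷ x ∷ o ∷ x ∷ o ∷ x ∷ o ∷ o ∷ []) , gv31) ∷
  ((o ∷ x ∷ o ∷ x ∷ o ∷ x ∷ o ∷ x ∷ o ∷ x ∷ []) , gv39) ∷
  ((x ∷ o ∷ x ∷ o ∷ x ∷ o ∷ x ∷ o ∷ x ∷ o ∷ []) , gv39) ∷
  ((x ∷ o ∷ x ∷ o ∷ x ∷ o ∷ x ∷ o ∷ x ∷ x ∷ []) , gv45) ∷
  ((x ∷ x ∷ o ∷ x ∷ o ∷ x ∷ o ∷ x ∷ o ∷ o ∷ []) , gv32) ∷
  ((x ∷ x ∷ o ∷ x ∷ o ∷ x ∷ o ∷ x ∷ o ∷ x ∷ []) , gv45) ∷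
  ((o ∷ o ∷ x ∷ o ∷ x ∷ o ∷ x ∷ o ∷ o ∷ []) , gv46) ∷
  ((o ∷ o ∷ x ∷ o ∷ x ∷ o ∷ x ∷ o ∷ x ∷ []) , gv47) ∷
  ((o ∷ x ∷ o ∷ x ∷ o ∷ x ∷ o ∷ x ∷ o ∷ []) , gv2) ∷
  ((o ∷ x ∷ o ∷ x ∷ o ∷ x ∷ o ∷ x ∷ x ∷ []) , gv48) ∷
  ((x ∷ o ∷ x ∷ o ∷ x ∷ o ∷ x ∷ o ∷ o ∷ []) , gv47) ∷
  ((x ∷ o ∷ x ∷ o ∷ x ∷ o ∷ x ∷ o ∷ x ∷ []) , gv3) ∷
  ((x ∷ x ∷ o ∷ x ∷ o ∷ x ∷ o ∷ x ∷ o ∷ []) , gv48) ∷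
  ((x ∷ x ∷ o ∷ x ∷ o ∷ x ∷ o ∷ x ∷ x ∷ []) , gv49) ∷
  ((o ∷ o ∷ x ∷ o ∷ x ∷ o ∷ x ∷ o ∷ []) , gv50) ∷
  ((o ∷ o ∷ x ∷ o ∷ x ∷ o ∷ x ∷ x ∷ []) , gv51) ∷
  ((o ∷ x ∷ o ∷ x ∷ o ∷ x ∷ o ∷ o ∷ []) , gv50) ∷
  ((o ∷ x ∷ o ∷ x ∷ o ∷ x ∷ o ∷ x ∷ []) , gv52) ∷
  ((x ∷ o ∷ x ∷ o ∷ x ∷ o ∷ x ∷ o ∷ []) , gv52) ∷
  ((x ∷ o ∷ x ∷ o ∷ x ∷ o ∷ x ∷ x ∷ []) , gv53) ∷
  ((x ∷ x ∷ o ∷ x ∷ o ∷ x ∷ o ∷ o ∷ []) , gv51) ∷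
  ((x ∷ x ∷ o ∷ x ∷ o ∷ x ∷ o ∷ x ∷ []) , gv53) ∷
  ((o ∷ o ∷ x ∷ o ∷ x ∷ o ∷ o ∷ []) , gv1) ∷
  ((o ∷ o ∷ x ∷ o ∷ x ∷ o ∷ x ∷ []) , gv54) ∷
  ((o ∷ x ∷ o ∷ x ∷ o ∷ x ∷ o ∷ []) , gv33) ∷
  ((o ∷ x ∷ o ∷ x ∷ o ∷ x ∷ x ∷ []) , gv55) ∷
  ((x ∷ o ∷ x ∷ o ∷ x ∷ o ∷ o ∷ []) , gv54) ∷
  ((x ∷ o ∷ x ∷ o ∷ x ∷ o ∷ x ∷ []) , gv38) ∷
  ((x ∷ x ∷ o ∷ x ∷ o ∷ x ∷ o ∷ []) , gv55) ∷
  ((x ∷ x ∷ o ∷ x ∷ o ∷ x ∷ x ∷ []) , gv1) ∷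
  ((o ∷ o ∷ x ∷ o ∷ x ∷ o ∷ []) , gv23) ∷
  ((o ∷ o ∷ x ∷ o ∷ x ∷ x ∷ []) , gv4) ∷
  ((o ∷ x ∷ o ∷ x ∷ o ∷ o ∷ []) , gv23) ∷
  ((o ∷ x ∷ o ∷ x ∷ o ∷ x ∷ []) , gv0) ∷
  ((x ∷ o ∷ x ∷ o ∷ x ∷ o ∷ []) , gv0) ∷
  ((x ∷ o ∷ x ∷ o ∷ x ∷ x ∷ []) , gv8) ∷
  ((x ∷ x ∷ o ∷ x ∷ o ∷ o ∷ []) , gv4) ∷
  ((x ∷ x ∷ o ∷ x ∷ o ∷ x ∷ []) , gv8) ∷
  ((o ∷ o ∷ x ∷ o ∷ o ∷ []) , gv7) ∷
  ((o ∷ o ∷ x ∷ o ∷ x ∷ []) , gv1) ∷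
  ((o ∷ x ∷ o ∷ x ∷ o ∷ []) , gv27) ∷
  ((o ∷ x ∷ o ∷ x ∷ x ∷ []) , gv1) ∷
  ((x ∷ o ∷ x ∷ o ∷ o ∷ []) , gv1) ∷
  ((x ∷ o ∷ x ∷ o ∷ x ∷ []) , gv41) ∷
  ((x ∷ x ∷ o ∷ x ∷ o ∷ []) , gv1) ∷
  ((x ∷ x ∷ o ∷ x ∷ x ∷ []) , gv5) ∷
  ((o ∷ o ∷ x ∷ o ∷ []) , gv2) ∷
  ((o ∷ o ∷ x ∷ x ∷ []) , gv0) ∷
  ((o ∷ x ∷ o ∷ o ∷ []) , gv2) ∷
  ((o ∷ x ∷ o ∷ x ∷ []) , gv10) ∷
  ((x ∷ o ∷ x ∷ o ∷ []) , gv10) ∷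
  ((x ∷ o ∷ x ∷ x ∷ []) , gv3) ∷
  ((x ∷ x ∷ o ∷ o ∷ []) , gv0) ∷
  ((x ∷ x ∷ o ∷ x ∷ []) , gv3) ∷
  ((o ∷ o ∷ o ∷ []) , gv0) ∷
  ((o ∷ o ∷ x ∷ []) , gv7) ∷
  ((o ∷ x ∷ o ∷ []) , gv1) ∷
  ((o ∷ x ∷ x ∷ []) , gv5) ∷
  ((x ∷ o ∷ o ∷ []) , gv7) ∷
  ((x ∷ o ∷ x ∷ []) , gv1) ∷
  ((x ∷ x ∷ o ∷ []) , gv5) ∷
  ((x ∷ x ∷ x ∷ []) , gv0) ∷
  ((o ∷ o ∷ []) , gv0) ∷
  ((o ∷ x ∷ []) , gv1) ∷
  ((x ∷ o ∷ []) , gv1) ∷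
  ((x ∷ x ∷ []) , gv0) ∷
  ((o ∷ []) , gv0) ∷
  ((x ∷ []) , gv0) ∷
  []


table-sound : SoundTable table
table-sound = checkTable-sound table _

-- Algorithm ASF

-- Rule η turns four stones into five, so the number of stones is not a termination
-- measure; the sum of 1 + |p|² over the parts is.
weight : Part → ℕ
weight p = suc (length p * length p)

μ : Position → ℕ
μ G = sum (map weight G)

μ-++ : ∀ A B → μ (A ++ B) ≡ μ A + μ B
μ-++ A B = trans (cong sum (map-++ weight A B)) (sum-++ (map weight A) (map weight B))

μ-↭ : ∀ {G H} → G ↭ H → μ G ≡ μ H
μ-↭ π = sum-↭ (map⁺ weight π)

weight-≅ : ∀ {p q} → p ≅ q → weight p ≡ weight q
weight-≅ (inj₁ refl)         = refl
weight-≅ {q = q} (inj₂ refl) = cong (λ n → suc (n * n)) (length-reverse q)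

certifiedReplacement : Part × Position → Bool
certifiedReplacement (q , rs) = (valuePosition table [ q ] ≃ᵐ valuePosition table rs) ∧ (μ rs <ᵇ weight q)

ruleCertified : Rule → Bool
ruleCertified (rw alts) = all certifiedReplacement alts
ruleCertified cancel    = true

asfRules-certified : T (all ruleCertified asfRules)
asfRules-certified = _

replacement-certified : ∀ {alts q rs} → T (all certifiedReplacement alts) → (q , rs) ∈ alts →
  toGame [ q ] ≃ toGame rs × μ rs < weight q
replacement-certified {alts} {q} {rs} t m
  with to (T-∧ {valuePosition table [ q ] ≃ᵐ valuePosition table rs}) (lookup (all⁺ certifiedReplacement alts t) m)
... | (t₁ , t₂) with ≃ᵐ-sound {valuePosition table [ q ]} t₁
...   | (g , h , e₁ , e₂ , g≃h) =
  (valuePosition-sound table-sound [ q ] e₁ ⟫ g≃h ⟫ ≃-sym (valuePosition-sound table-sound rs e₂)) , <ᵇ⇒< _ _ t₂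

pair-↭ : ∀ (A : Position) p B q C → A ++ p ∷ B ++ q ∷ C ↭ p ∷ q ∷ A ++ B ++ C
pair-↭ A p B q C = ↭-trans (shift p A (B ++ q ∷ C)) (↭-prep p (↭-trans (++⁺ˡ A (shift q B C)) (shift q A (B ++ C))))

Applies-≃ : ∀ {ρ G G′} → T (ruleCertified ρ) → Applies ρ G G′ → toGame G′ ≃ toGame G
Applies-≃ t (app-rw pre p suf q rs m p≅q) =
  toGame-↭ (shifts pre rs) ⟫
  ≃-sym (toGame-replace rs (pre ++ suf) (toGame-≅ p≅q ⟫ proj₁ (replacement-certified t m))) ⟫
  toGame-↭ (↭-sym (shift p pre suf))
Applies-≃ _ (app-cancel A p B q C q≅-p) = ≃-sym (toGame-↭ (pair-↭ A p B q C) ⟫ toGame-cancel p (A ++ B ++ C) q≅-p)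

Applies-μ : ∀ {ρ G G′} → T (ruleCertified ρ) → Applies ρ G G′ → μ G′ < μ G
Applies-μ t (app-rw pre p suf q rs m p≅q) = begin-strict
  μ (pre ++ rs ++ suf)      ≡⟨ μ-↭ (shifts pre rs) ⟩
  μ (rs ++ pre ++ suf)      ≡⟨ μ-++ rs (pre ++ suf) ⟩
  μ rs + μ (pre ++ suf)     <⟨ +-monoˡ-< (μ (pre ++ suf)) (proj₂ (replacement-certified t m)) ⟩
  weight q + μ (pre ++ suf) ≡⟨ cong (_+ μ (pre ++ suf)) (weight-≅ p≅q) ⟨
  μ (p ∷ pre ++ suf)        ≡⟨ μ-↭ (shift p pre suf) ⟨
  μ (pre ++ p ∷ suf)        ∎
  where open ≤-Reasoning
Applies-μ _ (app-cancel A p B q C _) = begin-strict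
  μ R                               <⟨ m<n+m (μ R) z<s ⟩
  weight q + μ R                    ≤⟨ m≤n+m (weight q + μ R) (weight p) ⟩
  μ (p ∷ q ∷ R)                     ≡⟨ μ-↭ (pair-↭ A p B q C) ⟨
  μ (A ++ p ∷ B ++ q ∷ C)           ∎
  where
  open ≤-Reasoning
  R = A ++ B ++ C

ASFStep-certified : ∀ {G G′} → ASFStep G G′ → ∃[ ρ ] (T (ruleCertified ρ) × Applies ρ G G′)
ASFStep-certified (step earlier ρ later eq _ app) =
  ρ , lookup (all⁺ ruleCertified asfRules asfRules-certified) (subst (ρ ∈_) (sym eq) (∈-insert earlier)) , app

ASFStep-≃ : ∀ {G G′} → ASFStep G G′ → toGame G′ ≃ toGame G
ASFStep-≃ st = let (ρ , t , app) = ASFStep-certified st in Applies-≃ t app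

ASFStep-μ : ∀ {G G′} → ASFStep G G′ → μ G′ < μ G
ASFStep-μ st = let (ρ , t , app) = ASFStep-certified st in Applies-μ t app

toGame-Star : ∀ {G H} → Star ASFStep G H → toGame H ≃ toGame G
toGame-Star ε          = ≃-refl
toGame-Star (st ◅ run) = toGame-Star run ⟫ ASFStep-≃ st

asf-terminates : ∀ G → Terminates G
asf-terminates = Subrelation.wellFounded ASFStep-μ (On.wellFounded μ <-wellFounded)

_≅?_ : ∀ p q → Dec (p ≅ q)
p ≅? q = (p ≟ᵖ q) ⊎-dec (p ≟ᵖ reverse q)

MatchesPattern : List (Part × List Part) → Part → Set
MatchesPattern alts p = Any (λ alt → p ≅ proj₁ alt) alts

Applicable-rw⁺ : ∀ {alts G} → Any (MatchesPattern alts) G → Applicable (rw alts) G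
Applicable-rw⁺ a with find a
... | (p , mG , match) with find match | ∈-∃++ mG
...   | ((q , rs) , m , p≅q) | (pre , suf , refl) = pre ++ rs ++ suf , app-rw pre p suf q rs m p≅q

Applicable-rw⁻ : ∀ {alts G} → Applicable (rw alts) G → Any (MatchesPattern alts) G
Applicable-rw⁻ (_ , app-rw pre p suf q rs m p≅q) = ++⁺ʳ pre (here (lose m p≅q))

data NegativePair : Position → Set where
  paired   : ∀ {p G} → Any (_≅ negPart p) G → NegativePair (p ∷ G)
  skip : ∀ {p G} → NegativePair G → NegativePair (p ∷ G)

negativePair? : ∀ G → Dec (NegativePair G)
negativePair? []      = no λ ()
negativePair? (p ∷ G) = map′ [ paired , skip ]′ (λ { (paired a) → inj₁ a ; (skip c) → inj₂ c })
                             (any? (_≅? negPart p) G ⊎-dec negativePair? G)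

NegativePair-++ : ∀ A {p B q C} → q ≅ negPart p → NegativePair (A ++ p ∷ B ++ q ∷ C)
NegativePair-++ []      {B = B} e = paired (++⁺ʳ B (here e))
NegativePair-++ (_ ∷ A) e         = skip (NegativePair-++ A e)

Applicable-cancel⁺ : ∀ {G} → NegativePair G → Applicable cancel G
Applicable-cancel⁺ (paired {p} a) with find a
... | (q , m , q≅-p) with ∈-∃++ m
...   | (B , C , refl) = B ++ C , app-cancel [] p B q C q≅-p
Applicable-cancel⁺ (skip {p} c) with Applicable-cancel⁺ c
... | (_ , app-cancel A p′ B q C e) = p ∷ A ++ B ++ C , app-cancel (p ∷ A) p′ B q C e

Applicable-cancel⁻ : ∀ {G} → Applicable cancel G → NegativePair G
Applicable-cancel⁻ (_ , app-cancel A p B q C e) = NegativePair-++ A e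

Applicable? : ∀ ρ G → Dec (Applicable ρ G)
Applicable? (rw alts) G = map′ Applicable-rw⁺ Applicable-rw⁻ (any? (λ p → any? (λ alt → p ≅? proj₁ alt) alts) G)
Applicable? cancel    G = map′ Applicable-cancel⁺ Applicable-cancel⁻ (negativePair? G)

First-split : ∀ {A : Set} {P Q : A → Set} {xs} → First P Q xs →
  ∃[ ys ] ∃[ y ] ∃[ zs ] (xs ≡ ys ++ y ∷ zs × All P ys × Q y)
First-split First.[ qy ]   = [] , _ , _ , refl , [] , qy
First-split (px First.∷ f) = let (ys , y , zs , eq , ps , qy) = First-split f in _ ∷ ys , y , zs , cong (_ ∷_) eq , px ∷ ps , qy

asf-progress : ∀ G → Halted G ⊎ ∃[ G′ ] ASFStep G G′
asf-progress G with first (λ ρ → swap (toSum (Applicable? ρ G))) asfRules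
... | inj₂ halted = inj₁ halted
... | inj₁ fst with First-split fst
...   | (earlier , ρ , later , eq , skipped , (G′ , app)) = inj₂ (G′ , step earlier ρ later eq skipped app)

asf-run : ∀ G → Terminates G → ∃[ H ] (Star ASFStep G H × Halted H)
asf-run G (acc rs) with asf-progress G
... | inj₁ halted    = G , ε , halted
... | inj₂ (G′ , st) = let (H , run , halted) = asf-run G′ (rs st) in H , st ◅ run , halted

-- ASF terminates and is sound on every position.
theorem2 : (G : Position) → ALC G →
    Terminates G
    × ∃[ H ] (Star ASFStep G H × Halted H)
    × (∀ H → Star ASFStep G H → Halted H → H ≈ G)
theorem2 G _ =
  let (H , run , halted) = asf-run G (asf-terminates G)
  in asf-terminates G , H , (run , halted) , λ H′ run′ _ → ≃⇒≈G (toGame-Star run′)
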